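{- Let $H$ be a $(0,1,2)$-multigraph of order $n\ge 3$ with exactly two distinct main eigenvalues whose $B$-graph is the cycle $C_n$, and let $a,b$ be integers such that $a\,d(v)+b=s(v)$ for every $v\in V(H)$. Label the vertices as follows: if $n$ is even, $V(H)=\{u_1,\dots,u_{n/2},v_1,\dots,v_{n/2}\}$ with $u_1u_2\cdots u_{n/2}v_{n/2}\cdots v_2v_1u_1$ the cycle of the $B$-graph; if $n$ is odd, $V(H)=\{u_1,\dots,u_{(n-1)/2},v_1,\dots,v_{(n-1)/2},x\}$ with $u_1\cdots u_{(n-1)/2}\,x\,v_{(n-1)/2}\cdots v_1u_1$ the cycle; and assume $w(u_1,v_1)=2$. If $w(u_1,u_2)=w(v_1,v_2)=2$, then $H$ is isomorphic to $U^4_{5t}$ or to $U^5_{4t}$ for some $t\ge 1$.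
   Context: A $(0,1,2)$-multigraph $H$ is a loopless multigraph in which any two distinct vertices $u,v$ are joined by $w(u,v)\in\{0,1,2\}$ edges; its adjacency matrix has $(u,v)$-entry $w(u,v)$. The degree is $d(v)=\sum_u w(u,v)$ and $s(v)=\sum_{u\sim v}w(u,v)d(u)$. The $B$-graph of $H$ is the simple graph on $V(H)$ with $u\sim v$ iff $w(u,v)\ge1$. An eigenvalue of the adjacency matrix is main if its eigenspace is not orthogonal to the all-ones vector. For $n_1\ge1,n_2\ge0,t\ge1$, $[n_1,n_2]_t$ denotes the $(0,1,2)$-multigraph on $x_0,\dots,x_{N-1}$, $N=(n_1+n_2)t$, whose edges join $x_i$ and $x_{i+1\bmod N}$ with multiplicity $2$ if $(i\bmod(n_1+n_2))<n_1$ and $1$ otherwise (around the cycle: $n_1$ consecutive double edges then $n_2$ consecutive single edges, repeated $t$ times). $U^4_{5t}=[3,2]_t$, $U^5_{4t}=[3,1]_t$. -}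

module Defs where

open import Level using (Level; 0ℓ) renaming (suc to lsuc)
open import Data.Nat as ℕ using (ℕ; zero; suc; NonZero; _≡ᵇ_; _<ᵇ_)
open import Data.Nat.DivMod using (_%_)
open import Data.Bool using (Bool; true; false; if_then_else_; _∨_; _∧_)
open import Data.Fin using (Fin; toℕ)
open import Data.List using (List; map)
open import Data.Nat.ListAction using (sum)
open import Data.List using () renaming (foldr to lfoldr)
open import Data.List.Base using (allFin)
open import Data.Integer as ℤ using (ℤ; +_)
open import Data.Product using (Σ; ∃; ∃-syntax; _×_; _,_)
open import Data.Sum using (_⊎_)
open import Relation.Nullary using (¬_)
open import Relation.Binary.PropositionalEquality using (_≡_)
open import Relation.Binary.Structures using (IsStrictTotalOrder)
open import Algebra.Bundles using (CommutativeRing)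
open import Function.Bundles using (_↔_; Inverse)

-- The real numbers, axiomatised as a complete ordered field
-- (any model is isomorphic to ℝ). Eigenvalues are taken in such a field.

record CompleteOrderedField : Set₁ where
  field
    commRing : CommutativeRing 0ℓ 0ℓ
  open CommutativeRing commRing public
  field
    _<_         : Carrier → Carrier → Set
    <-isSTO     : IsStrictTotalOrder _≈_ _<_
    1≉0         : ¬ (1# ≈ 0#)
    inverse     : ∀ x → ¬ (x ≈ 0#) → ∃[ y ] (x * y ≈ 1#)
    +-mono-<    : ∀ {x y} z → x < y → (x + z) < (y + z)
    *-pos       : ∀ {x y} → 0# < x → 0# < y → 0# < (x * y)
    sup         : (P : Carrier → Set) → (∃[ x ] P x) →
                  (∃[ b ] (∀ x → P x → ¬ (b < x))) →
                  ∃[ s ] ((∀ x → P x → ¬ (s < x)) ×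
                          (∀ b → (∀ x → P x → ¬ (b < x)) → ¬ (b < s)))

Weights : ℕ → Set
Weights n = Fin n → Fin n → ℕ

record Is012Multigraph {n : ℕ} (w : Weights n) : Set where
  field
    symmetric : ∀ u v → w u v ≡ w v u
    loopless  : ∀ v → w v v ≡ 0
    bounded   : ∀ u v → w u v ℕ.≤ 2

Σ[v] : ∀ {n} → (Fin n → ℕ) → ℕ
Σ[v] {n} f = sum (map f (allFin n))

deg : ∀ {n} → Weights n → Fin n → ℕ
deg w v = Σ[v] (λ u → w u v)

-- s(v) = Σ_{u ~ v} w(u,v) d(u)  (terms with w(u,v) = 0 vanish)
sdeg : ∀ {n} → Weights n → Fin n → ℕ
sdeg w v = Σ[v] (λ u → w u v ℕ.* deg w u)

-- The B-graph of H is the cycle C_n traversed (as a Hamiltonian cycle)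
-- by σ 0, σ 1, …, σ (n-1), σ 0 : σ is a bijection and
-- w(σ i, σ j) ≥ 1 iff i and j are cyclically consecutive.
cycAdj : ℕ → ℕ → ℕ → Bool
cycAdj N i j = (suc i ≡ᵇ j) ∨ ((suc i ≡ᵇ N) ∧ (j ≡ᵇ 0))

CycleLabelling : ∀ {n} → Weights n → (Fin n ↔ Fin n) → Set
CycleLabelling {n} w σ =
  ∀ i j → (1 ℕ.≤ w (f i) (f j)) ⇔' ((cycAdj n (toℕ i) (toℕ j) ∨ cycAdj n (toℕ j) (toℕ i)) ≡ true)
  where
    open Inverse σ using (to)
    f = to
    _⇔'_ : Set → Set → Set
    A ⇔' B = (A → B) × (B → A)

module Spectral (R : CompleteOrderedField) where
  open CompleteOrderedField R

  ⟦_⟧ : ℕ → Carrier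
  ⟦ zero ⟧  = 0#
  ⟦ suc k ⟧ = 1# + ⟦ k ⟧

  ΣR : ∀ {n} → (Fin n → Carrier) → Carrier
  ΣR {n} f = lfoldr _+_ 0# (map f (allFin n))

  InEigenspace : ∀ {n} → Weights n → Carrier → (Fin n → Carrier) → Set
  InEigenspace w λ′ x = ∀ u → ΣR (λ v → ⟦ w u v ⟧ * x v) ≈ λ′ * x u

  IsMainEigenvalue : ∀ {n} → Weights n → Carrier → Set
  IsMainEigenvalue w λ′ = ∃[ x ] (InEigenspace w λ′ x × ¬ (ΣR x ≈ 0#))

  ExactlyTwoMainEigenvalues : ∀ {n} → Weights n → Set
  ExactlyTwoMainEigenvalues w =
    ∃[ λ₁ ] ∃[ λ₂ ] (¬ (λ₁ ≈ λ₂) × IsMainEigenvalue w λ₁ × IsMainEigenvalue w λ₂ ×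
                    (∀ μ → IsMainEigenvalue w μ → (μ ≈ λ₁) ⊎ (μ ≈ λ₂)))

-- The multigraph [n₁,n₂]_t on x_0,…,x_{N-1}, N = (n₁+n₂)t:
-- x_i x_{i+1 mod N} has multiplicity 2 if (i mod (n₁+n₂)) < n₁, else 1.

edgeMult : (n₁ n₂ : ℕ) → .{{NonZero (n₁ ℕ.+ n₂)}} → ℕ → ℕ
edgeMult n₁ n₂ i = if (i % (n₁ ℕ.+ n₂)) <ᵇ n₁ then 2 else 1

bracket : (n₁ n₂ t : ℕ) → .{{_ : NonZero (n₁ ℕ.+ n₂)}} → Weights ((n₁ ℕ.+ n₂) ℕ.* t)
bracket n₁ n₂ t i j =
  if cycAdj N (toℕ i) (toℕ j) then edgeMult n₁ n₂ (toℕ i)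
  else if cycAdj N (toℕ j) (toℕ i) then edgeMult n₁ n₂ (toℕ j)
  else 0
  where N = (n₁ ℕ.+ n₂) ℕ.* t

U4 : (t : ℕ) → Weights (5 ℕ.* t)
U4 t = bracket 3 2 t

U5 : (t : ℕ) → Weights (4 ℕ.* t)
U5 t = bracket 3 1 t

_≅_ : ∀ {n m} → Weights n → Weights m → Set
_≅_ {n} {m} w w′ = Σ (Fin n ↔ Fin m) λ π →
  ∀ u v → w u v ≡ w′ (Inverse.to π u) (Inverse.to π v)

module Submission where

-- Along the cycle the edge multiplicities e₀, e₁, … are 1 or 2, and at the vertex
-- between e_{k+1} and e_{k+2} the hypothesis reads
--   a (e_{k+1} + e_{k+2}) + b = e_{k+1} (e_k + e_{k+1}) + e_{k+2} (e_{k+2} + e_{k+3}),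
-- which determines e_{k+3} from the three edges before it. Reading the cycle from
-- the double edges v₂v₁, v₁u₁, u₁u₂, the next three edges leave only three
-- possibilities: all edges double (then H is 4-regular and has a single main
-- eigenvalue), or the periodic patterns 2221 of U⁵ and 22211 of U⁴. In the last two
-- cases the period divides n, and rotating the labels gives the isomorphism.

open import Defs
open import Data.Nat using (ℕ; NonZero; _<_)
open import Data.Fin using (Fin)
open import Function.Bundles using (_↔_)

module Modular where

  open import Data.Nat using (suc; pred; _+_; _*_; NonZero)
  open import Data.Nat.Properties using (suc-pred)
  open import Data.Nat.DivMod using (_%_; %-distribˡ-+; m%n%n≡m%n; [m+kn]%n≡m%n)
  open import Data.Nat.Tactic.RingSolver using (solve-∀)
  open import Relation.Binary.PropositionalEquality
  open ≡-Reasoning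

  [m+n%d]%d≡[m+n]%d : ∀ m n d .{{_ : NonZero d}} → (m + n % d) % d ≡ (m + n) % d
  [m+n%d]%d≡[m+n]%d m n d = begin
    (m + n % d) % d           ≡⟨ %-distribˡ-+ m (n % d) d ⟩
    (m % d + n % d % d) % d   ≡⟨ cong (λ x → (m % d + x) % d) (m%n%n≡m%n n d) ⟩
    (m % d + n % d) % d       ≡⟨ %-distribˡ-+ m n d ⟨
    (m + n) % d               ∎

  %-cancelˡ-+ : ∀ c {x y} d .{{_ : NonZero d}} → (c + x) % d ≡ (c + y) % d → x % d ≡ y % d
  %-cancelˡ-+ c {x} {y} d eq = trans (undo x) (trans (cong (λ z → (c * pred d + z) % d) eq) (sym (undo y)))
    where
    shuffle : ∀ x c p → x + c * suc p ≡ c * p + (c + x)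
    shuffle = solve-∀
    -- adding c (d − 1) undoes adding c, modulo d
    undo : ∀ x → x % d ≡ (c * pred d + (c + x) % d) % d
    undo x = begin
      x % d                             ≡⟨ [m+kn]%n≡m%n x c d ⟨
      (x + c * d) % d                   ≡⟨ cong (λ m → (x + c * m) % d) (suc-pred d) ⟨
      (x + c * suc (pred d)) % d        ≡⟨ cong (_% d) (shuffle x c (pred d)) ⟩
      (c * pred d + (c + x)) % d        ≡⟨ [m+n%d]%d≡[m+n]%d (c * pred d) (c + x) d ⟨
      (c * pred d + (c + x) % d) % d    ∎

module FiniteSums where

  open import Data.Nat as ℕ using (ℕ; zero; suc)
  open import Data.Fin using (Fin; zero; suc)
  open import Data.Fin.Properties using (suc-injective)
  open import Data.List as List using (tabulate)
  open import Data.List.Properties using (map-tabulate)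
  import Data.Vec.Functional as Vector
  open import Data.Nat.Properties using (+-identityʳ; +-comm)
  open import Data.Empty using (⊥-elim)
  open import Relation.Binary.PropositionalEquality
  open import Function using (id; _∘_)

  foldr-tabulate : ∀ {A : Set} (_∙_ : A → A → A) (e : A) {n} (h : Fin n → A) →
    List.foldr _∙_ e (tabulate h) ≡ Vector.foldr _∙_ e h
  foldr-tabulate _∙_ e {zero}  h = refl
  foldr-tabulate _∙_ e {suc n} h = cong (h zero ∙_) (foldr-tabulate _∙_ e (h ∘ suc))

  foldr-map-allFin : ∀ {A : Set} (_∙_ : A → A → A) (e : A) {n} (h : Fin n → A) →
    List.foldr _∙_ e (List.map h (List.allFin n)) ≡ Vector.foldr _∙_ e h
  foldr-map-allFin _∙_ e h =
    trans (cong (List.foldr _∙_ e) (map-tabulate id h)) (foldr-tabulate _∙_ e h)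

  Σ[v]-suc : ∀ {n} (h : Fin (suc n) → ℕ) → Σ[v] h ≡ h zero ℕ.+ Σ[v] (h ∘ suc)
  Σ[v]-suc h = trans (foldr-map-allFin ℕ._+_ 0 h)
                     (cong (h zero ℕ.+_) (sym (foldr-map-allFin ℕ._+_ 0 (h ∘ suc))))

  Σ[v]-zero : ∀ {n} (h : Fin n → ℕ) → (∀ u → h u ≡ 0) → Σ[v] h ≡ 0
  Σ[v]-zero {zero}  h h≡0 = refl
  Σ[v]-zero {suc n} h h≡0 =
    trans (Σ[v]-suc h) (cong₂ ℕ._+_ (h≡0 zero) (Σ[v]-zero (h ∘ suc) (h≡0 ∘ suc)))

  Σ[v]-single : ∀ {n} (h : Fin n → ℕ) a → (∀ u → u ≢ a → h u ≡ 0) → Σ[v] h ≡ h a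
  Σ[v]-single h zero h≡0 = begin
    Σ[v] h                      ≡⟨ Σ[v]-suc h ⟩
    h zero ℕ.+ Σ[v] (h ∘ suc)   ≡⟨ cong (h zero ℕ.+_) (Σ[v]-zero (h ∘ suc) (λ u → h≡0 (suc u) λ ())) ⟩
    h zero ℕ.+ 0                ≡⟨ +-identityʳ (h zero) ⟩
    h zero                      ∎
    where open ≡-Reasoning
  Σ[v]-single h (suc a) h≡0 =
    trans (Σ[v]-suc h) (cong₂ ℕ._+_ (h≡0 zero λ ())
                                     (Σ[v]-single (h ∘ suc) a λ u u≢a → h≡0 (suc u) (u≢a ∘ suc-injective)))

  Σ[v]-pair : ∀ {n} (h : Fin n → ℕ) a b → a ≢ b → (∀ u → u ≢ a → u ≢ b → h u ≡ 0) →
    Σ[v] h ≡ h a ℕ.+ h b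
  Σ[v]-pair h zero    zero    a≢b _   = ⊥-elim (a≢b refl)
  Σ[v]-pair h zero    (suc b) _   h≡0 =
    trans (Σ[v]-suc h) (cong (h zero ℕ.+_)
      (Σ[v]-single (h ∘ suc) b λ u u≢b → h≡0 (suc u) (λ ()) (u≢b ∘ suc-injective)))
  Σ[v]-pair h (suc a) zero    _   h≡0 =
    trans (Σ[v]-suc h) (trans (cong (h zero ℕ.+_)
      (Σ[v]-single (h ∘ suc) a λ u u≢a → h≡0 (suc u) (u≢a ∘ suc-injective) (λ ())))
      (+-comm (h zero) (h (suc a))))
  Σ[v]-pair h (suc a) (suc b) a≢b h≡0 =
    trans (Σ[v]-suc h) (cong₂ ℕ._+_ (h≡0 zero (λ ()) (λ ()))
      (Σ[v]-pair (h ∘ suc) a b (a≢b ∘ cong suc)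
        λ u u≢a u≢b → h≡0 (suc u) (u≢a ∘ suc-injective) (u≢b ∘ suc-injective)))

module RegularSpectrum (R : CompleteOrderedField) where

  open import Data.Nat as ℕ using (ℕ; zero; suc)
  open import Data.Fin using (Fin; zero; suc)
  open import Data.Product using (_,_)
  open import Relation.Nullary using (¬_)
  import Relation.Binary.PropositionalEquality as ≡
  open import Function using (_∘_)
  open FiniteSums using (foldr-map-allFin; Σ[v]-suc)
  open CompleteOrderedField R hiding (zero)
  open Spectral R
  open import Algebra.Properties.Semiring.Sum semiring
    using (sum; sum-cong-≋; ∑-comm; *-distribˡ-sum; *-distribʳ-sum)
  open import Relation.Binary.Reasoning.Setoid setoid

  ΣR≡sum : ∀ {n} (h : Fin n → Carrier) → ΣR h ≡.≡ sum h
  ΣR≡sum = foldr-map-allFin _+_ 0#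

  ⟦⟧-homo-+ : ∀ m k → ⟦ m ℕ.+ k ⟧ ≈ ⟦ m ⟧ + ⟦ k ⟧
  ⟦⟧-homo-+ zero    k = sym (+-identityˡ ⟦ k ⟧)
  ⟦⟧-homo-+ (suc m) k = trans (+-congˡ (⟦⟧-homo-+ m k)) (sym (+-assoc 1# ⟦ m ⟧ ⟦ k ⟧))

  ⟦Σ[v]⟧ : ∀ {n} (h : Fin n → ℕ) → ⟦ Σ[v] h ⟧ ≈ sum (⟦_⟧ ∘ h)
  ⟦Σ[v]⟧ {zero}  h = refl
  ⟦Σ[v]⟧ {suc n} h = begin
    ⟦ Σ[v] h ⟧                        ≡⟨ ≡.cong ⟦_⟧ (Σ[v]-suc h) ⟩
    ⟦ h zero ℕ.+ Σ[v] (h ∘ suc) ⟧     ≈⟨ ⟦⟧-homo-+ (h zero) (Σ[v] (h ∘ suc)) ⟩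
    ⟦ h zero ⟧ + ⟦ Σ[v] (h ∘ suc) ⟧   ≈⟨ +-congˡ (⟦Σ[v]⟧ (h ∘ suc)) ⟩
    sum (⟦_⟧ ∘ h)                     ∎

  *-cancelʳ-≉0 : ∀ {x y z} → ¬ (z ≈ 0#) → x * z ≈ y * z → x ≈ y
  *-cancelʳ-≉0 {x} {y} {z} z≉0 xz≈yz with inverse z z≉0
  ... | z⁻¹ , zz⁻¹≈1 = begin
    x               ≈⟨ sym (*-identityʳ x) ⟩
    x * 1#          ≈⟨ *-congˡ (sym zz⁻¹≈1) ⟩
    x * (z * z⁻¹)   ≈⟨ sym (*-assoc x z z⁻¹) ⟩
    (x * z) * z⁻¹   ≈⟨ *-congʳ xz≈yz ⟩
    (y * z) * z⁻¹   ≈⟨ *-assoc y z z⁻¹ ⟩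
    y * (z * z⁻¹)   ≈⟨ *-congˡ zz⁻¹≈1 ⟩
    y * 1#          ≈⟨ *-identityʳ y ⟩
    y               ∎

  -- Summing the eigenvalue equation over all vertices turns A x = μ x into
  -- μ (Σ x) = r (Σ x), since every column of A sums to r.
  regular⇒mainEigenvalue≈degree : ∀ {n} (w : Weights n) (r : ℕ) → (∀ v → deg w v ≡.≡ r) →
    ∀ μ → IsMainEigenvalue w μ → μ ≈ ⟦ r ⟧
  regular⇒mainEigenvalue≈degree w r deg≡r μ (x , eigen , Σx≉0) =
    *-cancelʳ-≉0 (Σx≉0 ∘ trans (reflexive (ΣR≡sum x))) (begin
      μ * sum x                                 ≈⟨ *-distribˡ-sum μ x ⟩
      sum (λ u → μ * x u)                       ≈⟨ sum-cong-≋ (λ u → sym (eigenvector u)) ⟩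
      sum (λ u → sum (λ v → ⟦ w u v ⟧ * x v))   ≈⟨ ∑-comm (λ u v → ⟦ w u v ⟧ * x v) ⟩
      sum (λ v → sum (λ u → ⟦ w u v ⟧ * x v))   ≈⟨ sum-cong-≋ (λ v → sym (*-distribʳ-sum (x v) (λ u → ⟦ w u v ⟧))) ⟩
      sum (λ v → sum (λ u → ⟦ w u v ⟧) * x v)   ≈⟨ sum-cong-≋ (λ v → *-congʳ (columnSum v)) ⟩
      sum (λ v → ⟦ r ⟧ * x v)                   ≈⟨ sym (*-distribˡ-sum ⟦ r ⟧ x) ⟩
      ⟦ r ⟧ * sum x                             ∎)
    where
    eigenvector : ∀ u → sum (λ v → ⟦ w u v ⟧ * x v) ≈ μ * x u
    eigenvector u = trans (reflexive (≡.sym (ΣR≡sum (λ v → ⟦ w u v ⟧ * x v)))) (eigen u)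
    columnSum : ∀ v → sum (λ u → ⟦ w u v ⟧) ≈ ⟦ r ⟧
    columnSum v = trans (sym (⟦Σ[v]⟧ (λ u → w u v))) (reflexive (≡.cong ⟦_⟧ (deg≡r v)))

  regular⇒¬twoMainEigenvalues : ∀ {n} (w : Weights n) (r : ℕ) → (∀ v → deg w v ≡.≡ r) →
    ¬ ExactlyTwoMainEigenvalues w
  regular⇒¬twoMainEigenvalues w r deg≡r (λ₁ , λ₂ , λ₁≉λ₂ , main₁ , main₂ , _) =
    λ₁≉λ₂ (trans (regular⇒mainEigenvalue≈degree w r deg≡r λ₁ main₁)
                 (sym (regular⇒mainEigenvalue≈degree w r deg≡r λ₂ main₂)))

module EdgeSequences where

  open import Data.Nat as ℕ using (ℕ; suc; _<_; z<s; s≤s; NonZero; >-nonZero)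
  open import Data.Nat.Properties using (+-cancelˡ-≡; *-cancelˡ-≡; <ᵇ⇒<)
  open import Data.Nat.DivMod using (_%_; m%n<n)
  open import Data.Integer as ℤ using (ℤ; +_)
  open import Data.Integer.Properties using (+-injective)
  open import Data.Integer.Tactic.RingSolver using (solve-∀)
  open import Data.Sum as Sum using (_⊎_; inj₁; inj₂)
  open import Data.Empty using (⊥-elim)
  open import Data.Bool using (true; false; if_then_else_)
  open import Data.Bool.Properties using (T-≡)
  open import Function.Bundles using (Equivalence)
  open import Relation.Binary.PropositionalEquality
  open Equivalence using (from)
  open Modular using ([m+n%d]%d≡[m+n]%d)

  -- a d(v) + b = s(v) at a vertex joined by edges of multiplicities q and r to
  -- neighbours whose other edges have multiplicities p and s.
  VertexRelation : ℤ → ℤ → ℕ → ℕ → ℕ → ℕ → Set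
  VertexRelation a b p q r s = a ℤ.* + (q ℕ.+ r) ℤ.+ b ≡ + (q ℕ.* (p ℕ.+ q) ℕ.+ r ℕ.* (r ℕ.+ s))

  DegreeRelationAt : ℤ → ℤ → (ℕ → ℕ) → ℕ → Set
  DegreeRelationAt a b g k = VertexRelation a b (g k) (g (1 ℕ.+ k)) (g (2 ℕ.+ k)) (g (3 ℕ.+ k))

  DegreeRelation : ℤ → ℤ → (ℕ → ℕ) → Set
  DegreeRelation a b g = ∀ k → DegreeRelationAt a b g k

  edgeMult-cong : ∀ n₁ n₂ .{{_ : NonZero (n₁ ℕ.+ n₂)}} {x y} →
    x % (n₁ ℕ.+ n₂) ≡ y % (n₁ ℕ.+ n₂) → edgeMult n₁ n₂ x ≡ edgeMult n₁ n₂ y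
  edgeMult-cong n₁ n₂ = cong (λ r → if r ℕ.<ᵇ n₁ then 2 else 1)

  edgeMult≡2⇒% : ∀ n₁ n₂ .{{_ : NonZero (n₁ ℕ.+ n₂)}} x → edgeMult n₁ n₂ x ≡ 2 → x % (n₁ ℕ.+ n₂) < n₁
  edgeMult≡2⇒% n₁ n₂ x e with x % (n₁ ℕ.+ n₂) ℕ.<ᵇ n₁ in lt
  edgeMult≡2⇒% n₁ n₂ x e  | true = <ᵇ⇒< _ _ (from T-≡ lt)
  edgeMult≡2⇒% n₁ n₂ x () | false

  three-doubles⇒% : ∀ n₂ k → edgeMult 3 (suc n₂) k ≡ 2 → edgeMult 3 (suc n₂) (1 ℕ.+ k) ≡ 2 →
    edgeMult 3 (suc n₂) (2 ℕ.+ k) ≡ 2 → k % (3 ℕ.+ suc n₂) ≡ 0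
  three-doubles⇒% n₂ k e₀ e₁ e₂ = run (k % p) (edgeMult≡2⇒% 3 (suc n₂) k e₀) (shifted 1 e₁) (shifted 2 e₂)
    where
    p : ℕ
    p = 3 ℕ.+ suc n₂
    shifted : ∀ i → edgeMult 3 (suc n₂) (i ℕ.+ k) ≡ 2 → (i ℕ.+ k % p) % p < 3
    shifted i e = subst (_< 3) (sym ([m+n%d]%d≡[m+n]%d i k p)) (edgeMult≡2⇒% 3 (suc n₂) (i ℕ.+ k) e)
    run : ∀ r → r < 3 → (1 ℕ.+ r) % p < 3 → (2 ℕ.+ r) % p < 3 → r ≡ 0
    run 0 _ _ _ = refl
    run 1 _ _ (s≤s (s≤s (s≤s ())))
    run 2 _ (s≤s (s≤s (s≤s ()))) _
    run (suc (suc (suc _))) (s≤s (s≤s (s≤s ()))) _ _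

  affine-midpoint : ∀ (a b : ℤ) → (a ℤ.* + 2 ℤ.+ b) ℤ.+ (a ℤ.* + 4 ℤ.+ b) ≡ (a ℤ.* + 3 ℤ.+ b) ℤ.+ (a ℤ.* + 3 ℤ.+ b)
  affine-midpoint = solve-∀

  module _ {a b : ℤ} where

    VertexRelation-cong : ∀ {p q r s p′ q′ r′ s′} → p ≡ p′ → q ≡ q′ → r ≡ r′ → s ≡ s′ →
      VertexRelation a b p q r s → VertexRelation a b p′ q′ r′ s′
    VertexRelation-cong refl refl refl refl rel = rel

    VertexRelation-last-injective : ∀ {p q} r .{{_ : NonZero r}} {s s′} →
      VertexRelation a b p q r s → VertexRelation a b p q r s′ → s ≡ s′
    VertexRelation-last-injective {p = p} {q} r rel rel′ =
      +-cancelˡ-≡ r _ _ (*-cancelˡ-≡ _ _ r (+-cancelˡ-≡ (q ℕ.* (p ℕ.+ q)) _ _ (+-injective (trans (sym rel) rel′))))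

    relation-unique : ∀ {g h} → DegreeRelation a b g → DegreeRelation a b h → (∀ k → 0 < g k) →
      g 0 ≡ h 0 → g 1 ≡ h 1 → g 2 ≡ h 2 → ∀ k → g k ≡ h k
    relation-unique {g} {h} relg relh g>0 e₀ e₁ e₂ = agree
      where
      agree : ∀ k → g k ≡ h k
      agree 0 = e₀
      agree 1 = e₁
      agree 2 = e₂
      agree (suc (suc (suc k))) =
        VertexRelation-last-injective (g (2 ℕ.+ k)) {{>-nonZero (g>0 (2 ℕ.+ k))}} (relg k)
          (VertexRelation-cong (sym (agree k)) (sym (agree (suc k))) (sym (agree (suc (suc k)))) refl (relh k))

    relation-from-residues : ∀ n₁ n₂ .{{_ : NonZero (n₁ ℕ.+ n₂)}} →
      (∀ r → r < n₁ ℕ.+ n₂ → DegreeRelationAt a b (edgeMult n₁ n₂) r) → DegreeRelation a b (edgeMult n₁ n₂)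
    relation-from-residues n₁ n₂ residue k =
      VertexRelation-cong (shift 0) (shift 1) (shift 2) (shift 3) (residue (k % p) (m%n<n k p))
      where
      p : ℕ
      p = n₁ ℕ.+ n₂
      shift : ∀ i → edgeMult n₁ n₂ (i ℕ.+ k % p) ≡ edgeMult n₁ n₂ (i ℕ.+ k)
      shift i = edgeMult-cong n₁ n₂ ([m+n%d]%d≡[m+n]%d i k p)

    [3,1]-relation : VertexRelation a b 2 2 2 1 → VertexRelation a b 2 2 1 2 → DegreeRelation a b (edgeMult 3 1)
    [3,1]-relation r₄ r₃ = relation-from-residues 3 1 λ where
      0 _ → r₄
      1 _ → r₃
      2 _ → r₃
      3 _ → r₄
      (suc (suc (suc (suc _)))) (s≤s (s≤s (s≤s (s≤s ()))))

    [3,2]-relation : VertexRelation a b 2 2 2 1 → VertexRelation a b 2 2 1 1 → VertexRelation a b 2 1 1 2 →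
      DegreeRelation a b (edgeMult 3 2)
    [3,2]-relation r₄ r₃ r₂ = relation-from-residues 3 2 λ where
      0 _ → r₄
      1 _ → r₃
      2 _ → r₂
      3 _ → r₃
      4 _ → r₄
      (suc (suc (suc (suc (suc _))))) (s≤s (s≤s (s≤s (s≤s (s≤s ())))))

    -- After three double edges the next three select the candidate; in the remaining
    -- case (1,1,1) the relation would give a·2+b = 5, a·3+b = 10, a·4+b = 14, not affine.
    classify : ∀ {g} → DegreeRelation a b g → (∀ k → g k ≡ 1 ⊎ g k ≡ 2) →
      g 0 ≡ 2 → g 1 ≡ 2 → g 2 ≡ 2 →
      (∀ k → g k ≡ 2) ⊎ (∀ k → g k ≡ edgeMult 3 1 k) ⊎ (∀ k → g k ≡ edgeMult 3 2 k)
    classify {g} rel range g₀ g₁ g₂ =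
      Sum.map (agree-with refl refl refl) (Sum.map (agree-with refl refl refl) (agree-with refl refl refl)) candidate
      where
      at : ∀ k {p q r s} → g k ≡ p → g (1 ℕ.+ k) ≡ q → g (2 ℕ.+ k) ≡ r → g (3 ℕ.+ k) ≡ s → VertexRelation a b p q r s
      at k eq₀ eq₁ eq₂ eq₃ = VertexRelation-cong eq₀ eq₁ eq₂ eq₃ (rel k)

      positive : ∀ k → 0 < g k
      positive k with range k
      ... | inj₁ g≡1 = subst (0 <_) (sym g≡1) z<s
      ... | inj₂ g≡2 = subst (0 <_) (sym g≡2) z<s

      agree-with : ∀ {h} → h 0 ≡ 2 → h 1 ≡ 2 → h 2 ≡ 2 → DegreeRelation a b h → ∀ k → g k ≡ h k
      agree-with h₀ h₁ h₂ relh = relation-unique rel relh positive (trans g₀ (sym h₀)) (trans g₁ (sym h₁)) (trans g₂ (sym h₂))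

      candidate : DegreeRelation a b (λ _ → 2) ⊎ DegreeRelation a b (edgeMult 3 1) ⊎ DegreeRelation a b (edgeMult 3 2)
      candidate with range 3 | range 4 | range 5
      ... | inj₂ g₃ | _       | _       = inj₁ λ _ → at 0 g₀ g₁ g₂ g₃
      ... | inj₁ g₃ | inj₂ g₄ | _       = inj₂ (inj₁ ([3,1]-relation (at 0 g₀ g₁ g₂ g₃) (at 1 g₁ g₂ g₃ g₄)))
      ... | inj₁ g₃ | inj₁ g₄ | inj₂ g₅ =
        inj₂ (inj₂ ([3,2]-relation (at 0 g₀ g₁ g₂ g₃) (at 1 g₁ g₂ g₃ g₄) (at 2 g₂ g₃ g₄ g₅)))
      ... | inj₁ g₃ | inj₁ g₄ | inj₁ g₅ = ⊥-elim (19≢20 (begin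
        + 5 ℤ.+ + 14                                   ≡⟨ cong₂ ℤ._+_ (at 2 g₂ g₃ g₄ g₅) (at 0 g₀ g₁ g₂ g₃) ⟨
        (a ℤ.* + 2 ℤ.+ b) ℤ.+ (a ℤ.* + 4 ℤ.+ b)       ≡⟨ affine-midpoint a b ⟩
        (a ℤ.* + 3 ℤ.+ b) ℤ.+ (a ℤ.* + 3 ℤ.+ b)       ≡⟨ cong₂ ℤ._+_ (at 1 g₁ g₂ g₃ g₄) (at 1 g₁ g₂ g₃ g₄) ⟩
        + 10 ℤ.+ + 10                                  ∎))
        where
        open ≡-Reasoning
        19≢20 : + 19 ≢ + 20
        19≢20 ()

module Cycles where

  open Modular using ([m+n%d]%d≡[m+n]%d; %-cancelˡ-+)
  open import Data.Nat as ℕ using (ℕ; suc; pred; _+_; _∸_; _<_; _≤_; z<s; NonZero)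
  open import Data.Nat.Properties using (+-comm; +-assoc; +-identityʳ; <-trans; suc-pred; m∸n+n≡m; m+[n∸m]≡n; ≡ᵇ⇒≡; ≡⇒≡ᵇ; m≤n⇒m<n∨m≡n)
  open import Data.Nat.DivMod using (_%_; _mod_; m%n<n; m<n⇒m%n≡m; n%n≡0; [m+n]%n≡m%n)
  open import Data.Fin using (Fin; toℕ)
  open import Data.Fin.Properties using (toℕ-fromℕ<; toℕ-injective; toℕ<n)
  open import Data.Bool using (true; if_then_else_)
  open import Data.Bool.Properties using (T-≡; T-∨; T-∧; ⇔→≡)
  open import Data.Sum using (inj₁; inj₂)
  open import Data.Product using (_,_)
  open import Function.Bundles using (_⇔_; mk⇔; Equivalence; _↔_; mk↔ₛ′)
  open import Function.Construct.Composition using (_↔-∘_)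
  open import Relation.Binary.PropositionalEquality
  open Equivalence using (to; from)

  cycAdj⇒≡suc% : ∀ {N} .{{_ : NonZero N}} i j → j < N → cycAdj N i j ≡ true → j ≡ suc i % N
  cycAdj⇒≡suc% {N} i j j<N adj with to T-∨ (from T-≡ adj)
  ... | inj₁ 1+i≡ᵇj = sym (trans (m<n⇒m%n≡m (subst (_< N) (sym 1+i≡j) j<N)) 1+i≡j)
    where
    1+i≡j : suc i ≡ j
    1+i≡j = ≡ᵇ⇒≡ (suc i) j 1+i≡ᵇj
  ... | inj₂ wraps with to T-∧ wraps
  ...   | 1+i≡ᵇN , j≡ᵇ0 = begin
    j             ≡⟨ ≡ᵇ⇒≡ j 0 j≡ᵇ0 ⟩
    0             ≡⟨ n%n≡0 N ⟨
    N % N         ≡⟨ cong (_% N) (≡ᵇ⇒≡ (suc i) N 1+i≡ᵇN) ⟨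
    suc i % N     ∎
    where open ≡-Reasoning

  cycAdj-suc% : ∀ {N} .{{_ : NonZero N}} i → i < N → cycAdj N i (suc i % N) ≡ true
  cycAdj-suc% {N} i i<N with m≤n⇒m<n∨m≡n i<N
  ... | inj₁ 1+i<N rewrite m<n⇒m%n≡m 1+i<N = to T-≡ (from T-∨ (inj₁ (≡⇒≡ᵇ (suc i) (suc i) refl)))
  ... | inj₂ refl  rewrite n%n≡0 (suc i) ⦃ _ ⦄ = to T-≡ (from T-∧ (≡⇒≡ᵇ i i refl , _))

  -- bracket n₁ n₂ t is definitionally cycleMultigraph (edgeMult n₁ n₂) ((n₁ + n₂) * t).
  cycleMultigraph : (ℕ → ℕ) → (N : ℕ) → Weights N
  cycleMultigraph P N i j =
    if cycAdj N (toℕ i) (toℕ j) then P (toℕ i)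
    else if cycAdj N (toℕ j) (toℕ i) then P (toℕ j)
    else 0

  ≅-trans : ∀ {n m k} {w₁ : Weights n} {w₂ : Weights m} {w₃ : Weights k} → w₁ ≅ w₂ → w₂ ≅ w₃ → w₁ ≅ w₃
  ≅-trans (π , w₁≡w₂) (π′ , w₂≡w₃) = π′ ↔-∘ π , λ u v → trans (w₁≡w₂ u v) (w₂≡w₃ _ _)

  module Cyclic (n : ℕ) .{{_ : NonZero n}} where

    pos : ℕ → Fin n
    pos k = k mod n

    toℕ-pos : ∀ k → toℕ (pos k) ≡ k % n
    toℕ-pos k = toℕ-fromℕ< (m%n<n k n)

    pos-cong : ∀ {k l} → k % n ≡ l % n → pos k ≡ pos l
    pos-cong {k} {l} eq = toℕ-injective (trans (toℕ-pos k) (trans eq (sym (toℕ-pos l))))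

    pos-toℕ : ∀ i → pos (toℕ i) ≡ i
    pos-toℕ i = toℕ-injective (trans (toℕ-pos (toℕ i)) (m<n⇒m%n≡m (toℕ<n i)))

    pos≡ : ∀ {k} i → k % n ≡ toℕ i → pos k ≡ i
    pos≡ {k} i eq = trans (pos-cong (trans eq (sym (m<n⇒m%n≡m (toℕ<n i))))) (pos-toℕ i)

    rotate : ℕ → Fin n → Fin n
    rotate c i = pos (c + toℕ i)

    next : Fin n → Fin n
    next = rotate 1

    rotate-pos : ∀ c k → rotate c (pos k) ≡ pos (c + k)
    rotate-pos c k = pos-cong (trans (cong (λ x → (c + x) % n) (toℕ-pos k)) ([m+n%d]%d≡[m+n]%d c k n))

    pos-suc : ∀ k → pos (suc k) ≡ next (pos k)
    pos-suc k = sym (rotate-pos 1 k)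

    rotate-rotate : ∀ c d i → rotate c (rotate d i) ≡ rotate (c + d) i
    rotate-rotate c d i = trans (rotate-pos c (d + toℕ i)) (cong pos (sym (+-assoc c d (toℕ i))))

    rotate-n : ∀ i → rotate n i ≡ i
    rotate-n i = trans (pos-cong (trans (cong (_% n) (+-comm n (toℕ i))) ([m+n]%n≡m%n (toℕ i) n))) (pos-toℕ i)

    pos-suc-pred : ∀ i → pos (suc (pred n + toℕ i)) ≡ i
    pos-suc-pred i = trans (cong (λ c → rotate c i) (suc-pred n)) (rotate-n i)

    rotate-inverse : ∀ {c d} → d + c ≡ n → ∀ i → rotate d (rotate c i) ≡ i
    rotate-inverse {c} {d} d+c≡n i = trans (rotate-rotate d c i) (trans (cong (λ e → rotate e i) d+c≡n) (rotate-n i))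

    rotate-injective : ∀ c {i j} → rotate c i ≡ rotate c j → i ≡ j
    rotate-injective c {i} {j} eq = toℕ-injective (begin
      toℕ i       ≡⟨ m<n⇒m%n≡m (toℕ<n i) ⟨
      toℕ i % n   ≡⟨ %-cancelˡ-+ c n (trans (sym (toℕ-pos _)) (trans (cong toℕ eq) (toℕ-pos _))) ⟩
      toℕ j % n   ≡⟨ m<n⇒m%n≡m (toℕ<n j) ⟩
      toℕ j       ∎)
      where open ≡-Reasoning

    pos≢pos-2+ : 2 < n → ∀ k → pos k ≢ pos (2 + k)
    pos≢pos-2+ 2<n k eq = 0≢2 (begin
      0                 ≡⟨ m<n⇒m%n≡m (<-trans z<s 2<n) ⟨
      0 % n             ≡⟨ %-cancelˡ-+ k n (begin
        (k + 0) % n       ≡⟨ cong (_% n) (+-identityʳ k) ⟩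
        k % n             ≡⟨ toℕ-pos k ⟨
        toℕ (pos k)       ≡⟨ cong toℕ eq ⟩
        toℕ (pos (2 + k)) ≡⟨ toℕ-pos (2 + k) ⟩
        (2 + k) % n       ≡⟨ cong (_% n) (+-comm 2 k) ⟩
        (k + 2) % n       ∎) ⟩
      2 % n             ≡⟨ m<n⇒m%n≡m 2<n ⟩
      2                 ∎)
      where
      open ≡-Reasoning
      0≢2 : 0 ≢ 2
      0≢2 ()

    rotate-next : ∀ c i → rotate c (next i) ≡ next (rotate c i)
    rotate-next c i = trans (rotate-rotate c 1 i) (trans (cong (λ e → rotate e i) (+-comm c 1)) (sym (rotate-rotate 1 c i)))

    cycAdj⇔next : ∀ i j → cycAdj n (toℕ i) (toℕ j) ≡ true ⇔ j ≡ next i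
    cycAdj⇔next i j = mk⇔
      (λ adj → toℕ-injective (trans (cycAdj⇒≡suc% (toℕ i) (toℕ j) (toℕ<n j) adj) (sym (toℕ-pos _))))
      (λ { refl → subst (λ x → cycAdj n (toℕ i) x ≡ true) (sym (toℕ-pos _)) (cycAdj-suc% (toℕ i) (toℕ<n i)) })

    cycAdj-rotate : ∀ c i j → cycAdj n (toℕ (rotate c i)) (toℕ (rotate c j)) ≡ cycAdj n (toℕ i) (toℕ j)
    cycAdj-rotate c i j = ⇔→≡ (mk⇔
      (λ adj → from (cycAdj⇔next i j)
        (rotate-injective c (trans (to (cycAdj⇔next (rotate c i) (rotate c j)) adj) (sym (rotate-next c i)))))
      (λ adj → from (cycAdj⇔next (rotate c i) (rotate c j))
        (trans (cong (rotate c) (to (cycAdj⇔next i j) adj)) (rotate-next c i))))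

    cycleMultigraph-rotate : ∀ {P Q} c → c ≤ n → (∀ k → Q k ≡ P ((c + k) % n)) →
      cycleMultigraph Q n ≅ cycleMultigraph P n
    cycleMultigraph-rotate {P} {Q} c c≤n Q≡P = π , weights
      where
      π : Fin n ↔ Fin n
      π = mk↔ₛ′ (rotate c) (rotate (n ∸ c)) (rotate-inverse (m+[n∸m]≡n c≤n)) (rotate-inverse (m∸n+n≡m c≤n))
      weights : ∀ i j → cycleMultigraph Q n i j ≡ cycleMultigraph P n (rotate c i) (rotate c j)
      weights i j rewrite cycAdj-rotate c i j | cycAdj-rotate c j i
                        | toℕ-pos (c + toℕ i) | toℕ-pos (c + toℕ j) | Q≡P (toℕ i) | Q≡P (toℕ j) = refl

module LabelledCycle {n} .{{_ : NonZero n}} (2<n : 2 < n) {w : Weights n} (W : Is012Multigraph w)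
                     (σ : Fin n ↔ Fin n) (cyc : CycleLabelling w σ) where

  open import Data.Nat as ℕ using (ℕ; zero; suc; pred; _+_; _*_; _∸_; _<_; _≤_; z≤n; s≤s)
  open import Data.Nat.Properties using (+-comm; +-assoc; +-commutativeSemigroup; m∸n≤m; m+[n∸m]≡n; *-comm; n≤0⇒n≡0; ≮⇒≥; n≮0)
  open import Data.Nat.DivMod using (_%_; _/_; m≡m%n+[m/n]*n; [m+n]%n≡m%n)
  open import Algebra.Properties.CommutativeSemigroup +-commutativeSemigroup using (xy∙z≈xz∙y)
  open import Data.Integer as ℤ using (ℤ; +_)
  open import Data.Fin using (Fin; toℕ)
  open import Data.Bool using (true; false)
  open import Data.Bool.Properties using (T-≡; T-∨; not-¬)
  open import Data.Sum as Sum using (_⊎_; inj₁; inj₂)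
  open import Data.Product using (_,_; proj₁; proj₂; ∃-syntax; _×_)
  open import Data.Empty using (⊥-elim)
  open import Function using (_∘_)
  open import Function.Bundles using (_↔_; Inverse; Equivalence)
  open import Function.Construct.Symmetry using (↔-sym)
  open import Relation.Binary.PropositionalEquality
  open Equivalence using (to; from)
  open FiniteSums using (Σ[v]-pair)
  open Modular using ([m+n%d]%d≡[m+n]%d)
  open EdgeSequences using (DegreeRelation; three-doubles⇒%)
  open Cycles
  open Cyclic n public
  open Is012Multigraph W public

  vertex : Fin n → Fin n
  vertex = Inverse.to σ

  position : Fin n → Fin n
  position = Inverse.from σ

  vertex-position : ∀ v → vertex (position v) ≡ v
  vertex-position = Inverse.strictlyInverseˡ σ

  vertex-injective : ∀ {i j} → vertex i ≡ vertex j → i ≡ j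
  vertex-injective {i} {j} eq =
    trans (sym (Inverse.strictlyInverseʳ σ i)) (trans (cong position eq) (Inverse.strictlyInverseʳ σ j))

  adjacent : ∀ i j → 1 ≤ w (vertex i) (vertex j) → j ≡ next i ⊎ i ≡ next j
  adjacent i j w≥1 = Sum.map (to (cycAdj⇔next i j) ∘ to T-≡) (to (cycAdj⇔next j i) ∘ to T-≡)
                             (to T-∨ (from T-≡ (proj₁ (cyc i j) w≥1)))

  adjacent-next : ∀ i → 1 ≤ w (vertex i) (vertex (next i))
  adjacent-next i = proj₂ (cyc i (next i)) (to T-≡ (from T-∨ (inj₁ (from T-≡ (from (cycAdj⇔next i (next i)) refl)))))

  edge : ℕ → ℕ
  edge k = w (vertex (pos k)) (vertex (pos (suc k)))

  edge-next : ∀ k → edge k ≡ w (vertex (pos k)) (vertex (next (pos k)))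
  edge-next k = cong (w (vertex (pos k)) ∘ vertex) (pos-suc k)

  edge-cong : ∀ {k l} → k % n ≡ l % n → edge k ≡ edge l
  edge-cong {k} {l} eq =
    trans (edge-next k) (trans (cong (λ i → w (vertex i) (vertex (next i))) (pos-cong eq)) (sym (edge-next l)))

  one-or-two : ∀ {x} → 1 ≤ x → x ≤ 2 → x ≡ 1 ⊎ x ≡ 2
  one-or-two {1} _ _ = inj₁ refl
  one-or-two {2} _ _ = inj₂ refl
  one-or-two {suc (suc (suc _))} _ (s≤s (s≤s ()))

  edge-range : ∀ k → edge k ≡ 1 ⊎ edge k ≡ 2
  edge-range k = one-or-two (subst (1 ≤_) (sym (edge-next k)) (adjacent-next (pos k))) (bounded _ _)

  neighbours : ∀ j k → 1 ≤ w (vertex j) (vertex (pos (suc k))) → j ≡ pos k ⊎ j ≡ pos (2 + k)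
  neighbours j k adj = Sum.map
    (λ e → sym (rotate-injective 1 (trans (sym (pos-suc k)) e)))
    (λ e → trans e (sym (pos-suc (suc k))))
    (adjacent j (pos (suc k)) adj)

  w-off-neighbours : ∀ k u → u ≢ vertex (pos k) → u ≢ vertex (pos (2 + k)) → w u (vertex (pos (suc k))) ≡ 0
  w-off-neighbours k u u≢₀ u≢₂ = n≤0⇒n≡0 (≮⇒≥ λ adj → Sum.[ u≢₀ ∘ at , u≢₂ ∘ at ]
    (neighbours (position u) k (subst (λ x → 1 ≤ w x (vertex (pos (suc k)))) (sym (vertex-position u)) adj)))
    where
    at : ∀ {j} → position u ≡ j → u ≡ vertex j
    at e = trans (sym (vertex-position u)) (cong vertex e)

  neighbours-distinct : ∀ k → vertex (pos k) ≢ vertex (pos (2 + k))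
  neighbours-distinct k = pos≢pos-2+ 2<n k ∘ vertex-injective

  deg-edge : ∀ k → deg w (vertex (pos (suc k))) ≡ edge k + edge (suc k)
  deg-edge k = trans (Σ[v]-pair (λ u → w u v) _ _ (neighbours-distinct k) (w-off-neighbours k))
                     (cong (λ x → edge k + x) (symmetric _ _))
    where
    v : Fin n
    v = vertex (pos (suc k))

  sdeg-edge : ∀ k → sdeg w (vertex (pos (suc k))) ≡
    edge k * deg w (vertex (pos k)) + edge (suc k) * deg w (vertex (pos (2 + k)))
  sdeg-edge k =
    trans (Σ[v]-pair (λ u → w u v * deg w u) _ _ (neighbours-distinct k)
                     (λ u u≢₀ u≢₂ → cong (_* deg w u) (w-off-neighbours k u u≢₀ u≢₂)))
          (cong (λ x → edge k * deg w (vertex (pos k)) + x * deg w (vertex (pos (2 + k)))) (symmetric _ _))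
    where
    v : Fin n
    v = vertex (pos (suc k))

  edge-relation : ∀ {a b} → (∀ v → a ℤ.* + deg w v ℤ.+ b ≡ + sdeg w v) → DegreeRelation a b edge
  edge-relation {a} {b} rel k = begin
    a ℤ.* + (edge (1 + k) + edge (2 + k)) ℤ.+ b
      ≡⟨ cong (λ d → a ℤ.* + d ℤ.+ b) (deg-edge (suc k)) ⟨
    a ℤ.* + deg w v ℤ.+ b
      ≡⟨ rel v ⟩
    + sdeg w v
      ≡⟨ cong +_ (sdeg-edge (suc k)) ⟩
    + (edge (1 + k) * deg w (vertex (pos (1 + k))) + edge (2 + k) * deg w (vertex (pos (3 + k))))
      ≡⟨ cong₂ (λ d d′ → + (edge (1 + k) * d + edge (2 + k) * d′)) (deg-edge k) (deg-edge (2 + k)) ⟩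
    + (edge (1 + k) * (edge k + edge (1 + k)) + edge (2 + k) * (edge (2 + k) + edge (3 + k)))
      ∎
    where
    open ≡-Reasoning
    v : Fin n
    v = vertex (pos (2 + k))

  edge-regular : ∀ {c} → (∀ k → edge k ≡ c) → ∀ v → deg w v ≡ c + c
  edge-regular {c} edge≡c v = begin
    deg w v                       ≡⟨ cong (deg w) (vertex-position v) ⟨
    deg w (vertex j)              ≡⟨ cong (deg w ∘ vertex) (pos-suc-pred j) ⟨
    deg w (vertex (pos (suc k)))  ≡⟨ deg-edge k ⟩
    edge k + edge (suc k)         ≡⟨ cong₂ _+_ (edge≡c k) (edge≡c (suc k)) ⟩
    c + c                         ∎
    where
    open ≡-Reasoning
    j : Fin n
    j = position v
    k : ℕ
    k = pred n + toℕ j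

  w≅cycleMultigraph-edge : w ≅ cycleMultigraph edge n
  w≅cycleMultigraph-edge = ↔-sym σ , λ u v →
    trans (cong₂ w (sym (vertex-position u)) (sym (vertex-position v))) (weights (position u) (position v))
    where
    edge-toℕ : ∀ i → edge (toℕ i) ≡ w (vertex i) (vertex (next i))
    edge-toℕ i = cong (λ j → w (vertex j) (vertex (next i))) (pos-toℕ i)
    non-adjacent : ∀ i j → cycAdj n (toℕ i) (toℕ j) ≡ false → cycAdj n (toℕ j) (toℕ i) ≡ false →
      w (vertex i) (vertex j) ≡ 0
    non-adjacent i j ¬adj ¬adj′ = n≤0⇒n≡0 (≮⇒≥ (Sum.[ not-¬ ¬adj ∘ from (cycAdj⇔next i j)
                                                     , not-¬ ¬adj′ ∘ from (cycAdj⇔next j i) ] ∘ adjacent i j))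
    weights : ∀ i j → w (vertex i) (vertex j) ≡ cycleMultigraph edge n i j
    weights i j with cycAdj n (toℕ i) (toℕ j) in adj
    ... | true  = trans (cong (w (vertex i) ∘ vertex) (to (cycAdj⇔next i j) adj)) (sym (edge-toℕ i))
    ... | false with cycAdj n (toℕ j) (toℕ i) in adj′
    ...   | true  = trans (symmetric _ _) (trans (cong (w (vertex j) ∘ vertex) (to (cycAdj⇔next j i) adj′)) (sym (edge-toℕ j)))
    ...   | false = non-adjacent i j adj adj′

  edge≡w : ∀ k {i j} → k % n ≡ toℕ i → suc k % n ≡ toℕ j → edge k ≡ w (vertex i) (vertex j)
  edge≡w k i≡ j≡ = cong₂ (λ i j → w (vertex i) (vertex j)) (pos≡ _ i≡) (pos≡ _ j≡)

  ReadsFrom : ℕ → (ℕ → ℕ) → Set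
  ReadsFrom s P = ∀ k → edge (k + s) ≡ P k

  module _ {s P} (reads : ReadsFrom s P) where

    reads-periodic : ∀ k → P (k + n) ≡ P k
    reads-periodic k = begin
      P (k + n)         ≡⟨ reads (k + n) ⟨
      edge (k + n + s)  ≡⟨ edge-cong (trans (cong (_% n) (xy∙z≈xz∙y k n s)) ([m+n]%n≡m%n (k + s) n)) ⟩
      edge (k + s)      ≡⟨ reads k ⟩
      P k               ∎
      where open ≡-Reasoning

    module _ (s≤n : s ≤ n) where

      reads-rotated : ∀ k → edge k ≡ P ((n ∸ s + k) % n)
      reads-rotated k = trans (edge-cong (sym back)) (reads ((n ∸ s + k) % n))
        where
        open ≡-Reasoning
        back : ((n ∸ s + k) % n + s) % n ≡ k % n
        back = begin
          ((n ∸ s + k) % n + s) % n   ≡⟨ cong (_% n) (+-comm _ s) ⟩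
          (s + (n ∸ s + k) % n) % n   ≡⟨ [m+n%d]%d≡[m+n]%d s (n ∸ s + k) n ⟩
          (s + (n ∸ s + k)) % n       ≡⟨ cong (_% n) (+-assoc s (n ∸ s) k) ⟨
          (s + (n ∸ s) + k) % n       ≡⟨ cong (λ x → (x + k) % n) (m+[n∸m]≡n s≤n) ⟩
          (n + k) % n                 ≡⟨ cong (_% n) (+-comm n k) ⟩
          (k + n) % n                 ≡⟨ [m+n]%n≡m%n k n ⟩
          k % n                       ∎

      reads-≅ : w ≅ cycleMultigraph P n
      reads-≅ = ≅-trans {w₃ = cycleMultigraph P n} w≅cycleMultigraph-edge
                        (cycleMultigraph-rotate {P} (n ∸ s) (m∸n≤m n s) reads-rotated)

  reads-bracket⇒≅ : ∀ {s} n₂ → s ≤ n → ReadsFrom s (edgeMult 3 (suc n₂)) →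
    ∃[ t ] (1 ≤ t × w ≅ bracket 3 (suc n₂) t)
  reads-bracket⇒≅ n₂ s≤n reads =
    n / p , t≥1 , subst (w ≅_ ∘ cycleMultigraph (edgeMult 3 (suc n₂))) (trans n≡t*p (*-comm (n / p) p))
                        (reads-≅ reads s≤n)
    where
    p : ℕ
    p = 3 + suc n₂
    n≡t*p : n ≡ n / p * p
    n≡t*p = trans (m≡m%n+[m/n]*n n p) (cong (_+ n / p * p) n%p≡0)
      where
      n%p≡0 : n % p ≡ 0
      n%p≡0 = three-doubles⇒% n₂ n (reads-periodic reads 0) (reads-periodic reads 1) (reads-periodic reads 2)
    t≥1 : 1 ≤ n / p
    t≥1 with n / p | n≡t*p
    ... | zero  | n≡0 = ⊥-elim (n≮0 (subst (2 <_) n≡0 2<n))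
    ... | suc _ | _   = s≤s z≤n

open import Data.Nat using (ℕ; _≤_; _∸_)
open import Data.Fin using (Fin; toℕ)
open import Data.Integer using (ℤ; +_; _+_; _*_)
open import Data.Product using (∃-syntax; _×_)
open import Data.Sum using (_⊎_)
open import Relation.Binary.PropositionalEquality using (_≡_)
open import Function.Bundles using (_↔_; Inverse)

open import Data.Nat as ℕ using (suc; s≤s)
open import Data.Nat.Properties using (n≤1+n; m≤n+m; ≤-refl)
open import Data.Nat.DivMod using (_%_; m<n⇒m%n≡m; n%n≡0; [m+n]%n≡m%n)
open import Data.Sum as Sum using (inj₁; inj₂)
open import Data.Product as Product using ()
open import Data.Empty using (⊥-elim)
open import Relation.Binary.PropositionalEquality using (sym; trans)
open RegularSpectrum using (regular⇒¬twoMainEigenvalues)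
open EdgeSequences using (classify)

theorem3p7 : (R : CompleteOrderedField) (n : ℕ) (w : Weights n) →
    3 ≤ n → Is012Multigraph w → Spectral.ExactlyTwoMainEigenvalues R w →
    (a b : ℤ) → (∀ v → a * (+ deg w v) + b ≡ + sdeg w v) →
    (σ : Fin n ↔ Fin n) → CycleLabelling w σ →
    (i0 i1 j1 j2 : Fin n) →
    toℕ i0 ≡ 0 → toℕ i1 ≡ 1 → toℕ j1 ≡ n ∸ 1 → toℕ j2 ≡ n ∸ 2 →
    w (Inverse.to σ i0) (Inverse.to σ j1) ≡ 2 →
    w (Inverse.to σ i0) (Inverse.to σ i1) ≡ 2 →
    w (Inverse.to σ j1) (Inverse.to σ j2) ≡ 2 →
    ∃[ t ] (1 ≤ t × ((w ≅ U4 t) ⊎ (w ≅ U5 t)))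
theorem3p7 R (suc (suc (suc m))) w 2<n@(s≤s (s≤s (s≤s _))) W twoMain a b rel σ cyc
           i₀ i₁ j₁ j₂ i₀≡0 i₁≡1 j₁≡n-1 j₂≡n-2 u₁v₁ u₁u₂ v₁v₂ =
  Sum.[ (λ all-double → ⊥-elim (regular⇒¬twoMainEigenvalues R w 4
                                 (edge-regular (reads-rotated all-double s≤n)) twoMain))
      , Sum.[ (λ reads-[3,1] → Product.map₂ (Product.map₂ inj₂) (reads-bracket⇒≅ 0 s≤n reads-[3,1]))
            , (λ reads-[3,2] → Product.map₂ (Product.map₂ inj₁) (reads-bracket⇒≅ 1 s≤n reads-[3,2])) ] ]
    (classify {a} {b} (λ k → edge-relation {a} {b} rel (k ℕ.+ s)) (λ k → edge-range (k ℕ.+ s))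
              double-v₂v₁ double-v₁u₁ double-u₁u₂)
  where
  open LabelledCycle 2<n W σ cyc
  s : ℕ
  s = suc m
  s≤n : s ≤ 3 ℕ.+ m
  s≤n = s≤s (m≤n+m m 2)
  at-v₂ : suc m % (3 ℕ.+ m) ≡ toℕ j₂
  at-v₂ = trans (m<n⇒m%n≡m (s≤s (s≤s (n≤1+n m)))) (sym j₂≡n-2)
  at-v₁ : (2 ℕ.+ m) % (3 ℕ.+ m) ≡ toℕ j₁
  at-v₁ = trans (m<n⇒m%n≡m ≤-refl) (sym j₁≡n-1)
  at-u₁ : (3 ℕ.+ m) % (3 ℕ.+ m) ≡ toℕ i₀
  at-u₁ = trans (n%n≡0 (3 ℕ.+ m)) (sym i₀≡0)
  at-u₂ : (4 ℕ.+ m) % (3 ℕ.+ m) ≡ toℕ i₁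
  at-u₂ = trans ([m+n]%n≡m%n 1 (3 ℕ.+ m)) (sym i₁≡1)
  double-v₂v₁ : edge (1 ℕ.+ m) ≡ 2
  double-v₂v₁ = trans (edge≡w (1 ℕ.+ m) at-v₂ at-v₁) (trans (symmetric _ _) v₁v₂)
  double-v₁u₁ : edge (2 ℕ.+ m) ≡ 2
  double-v₁u₁ = trans (edge≡w (2 ℕ.+ m) at-v₁ at-u₁) (trans (symmetric _ _) u₁v₁)
  double-u₁u₂ : edge (3 ℕ.+ m) ≡ 2
  double-u₁u₂ = trans (edge≡w (3 ℕ.+ m) at-u₁ at-u₂) u₁u₂
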